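{- Every weighted Dyck word $w$ may be constructed from $\star$ (the word of size $0$), recursively using the insertion procedure.
   Context: Let $\star$ denote a letter representing a box of the basement. A weighted Dyck word is a word $w$ with letters in $\{\star,U,D\}\cup\mathbb{N}$ such that: (i) $w$ belongs to the language $\left(\star(U+D)\mathbb{N}(U+D)\right)^*\star$; (ii) the subword of $w$ in the letters $D$ and $U$ is a Dyck word (every prefix has at least as many $D$'s as $U$'s, with equality for the whole word); (iii) for each position $i$ with $w(i)\in\mathbb{N}$, $w(i)<ch(i,w)$, where $ch(i,w):=\left\lceil \frac{|\{ j<i \mid w(j)=D \}| - |\{ j<i \mid w(j)=U \}|}{2}\right\rceil$ is the column height. The integer letters are the weights; the size is the number of weights. A weight $w(i)$ is maximal if $w(i)=ch(i,w)-1$; it is eligible if it is maximal and immediately preceded by $D$; the special weight is the right-most eligible weight. A column addition replaces a letter $\star$ at position $i$ by $\star\, D\, m\, U\, \star$ with $m=ch(i,w)-1$ (the new weight). A ribbon addition on a letter $U$ placed before a letter $D$ exchanges these two letters. The insertion procedure, applied to a weighted Dyck word of size $k\ge0$, is: (1) find the special weight $s$ (skipped if $k=0$); (2) choose a letter $\star$; (3) perform a column addition at the chosen $\star$; (4) if the chosen $\star$ is to the left of $s$, perform a ribbon addition on the $U$ letter following the new weight and the $D$ letter preceding $s$. It produces a weighted Dyck word of size $k+1$. -}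

module Defs where

open import Data.Nat using (ℕ; zero; suc; ⌈_/2⌉; ⌊_/2⌋)
open import Data.Integer using (ℤ; +_; -[1+_]; _+_; -_; _<_; _≤_; 0ℤ; 1ℤ)
open import Data.List using (List; []; _∷_; _++_; length)
open import Data.Product using (Σ; ∃; _×_; _,_)
open import Data.Sum using (_⊎_)
open import Relation.Nullary using (¬_)
open import Relation.Binary.PropositionalEquality using (_≡_)
open import Relation.Binary.Construct.Closure.ReflexiveTransitive using (Star)
import Data.Nat as ℕ

-- Letters: ⋆ (a box of the basement), U, D, and natural-number weights.
data Letter : Set where
  star : Letter
  U    : Letter
  D    : Letter
  num  : ℕ → Letter

Word : Set
Word = List Letter

height : Word → ℤ
height []          = 0ℤ
height (D ∷ w)     = 1ℤ + height w
height (U ∷ w)     = - 1ℤ + height w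
height (star ∷ w)  = height w
height (num _ ∷ w) = height w

ceilHalf : ℤ → ℤ
ceilHalf (+ n)      = + ⌈ n /2⌉
ceilHalf -[1+ n ]   = - (+ ⌊ suc n /2⌋)

-- column height ch(i,w), where p is the prefix of w strictly before position i
ch : Word → ℤ
ch p = ceilHalf (height p)

data UD : Letter → Set where
  isU : UD U
  isD : UD D

data InLang : Word → Set where
  last : InLang (star ∷ [])
  box  : ∀ {x y n w} → UD x → UD y → InLang w → InLang (star ∷ x ∷ num n ∷ y ∷ w)

-- (ii) the U/D subword is a Dyck word (D = up step)
IsDyck : Word → Set
IsDyck w = (∀ p q → w ≡ p ++ q → 0ℤ ≤ height p) × height w ≡ 0ℤ

WeightsOK : Word → Set
WeightsOK w = ∀ p n q → w ≡ p ++ num n ∷ q → + n < ch p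

WeightedDyck : Word → Set
WeightedDyck w = InLang w × IsDyck w × WeightsOK w

size : Word → ℕ
size []          = 0
size (num _ ∷ w) = suc (size w)
size (_ ∷ w)     = size w

-- w = a ++ D ∷ num s ∷ b with s eligible (maximal and preceded by D)
Eligible : Word → Word → ℕ → Word → Set
Eligible w a s b = w ≡ a ++ D ∷ num s ∷ b × + suc s ≡ ch (a ++ D ∷ [])

Special : Word → Word → ℕ → Word → Set
Special w a s b = Eligible w a s b ×
  (∀ a' s' b' → Eligible w a' s' b' → length a' ℕ.≤ length a)

Insertion : Word → Word → Set
Insertion w w' = WeightedDyck w × Σ Word λ pre → Σ Word λ post → Σ ℕ λ m →
  w ≡ pre ++ star ∷ post × + suc m ≡ ch (pre ++ star ∷ D ∷ []) ×
  ( -- chosen ⋆ not to the left of the special weight (or no special weight): column addition only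
    ((∀ c s b → ¬ Special w (pre ++ star ∷ c) s b) ×
      w' ≡ pre ++ star ∷ D ∷ num m ∷ U ∷ star ∷ post)
  ⊎ -- chosen ⋆ to the left of the special weight s: column addition then ribbon addition
    (Σ Word λ c → Σ ℕ λ s → Σ Word λ b → Special w (pre ++ star ∷ c) s b ×
      w' ≡ pre ++ star ∷ D ∷ num m ∷ D ∷ star ∷ c ++ U ∷ num s ∷ b))

Constructible : Word → Set
Constructible w = Star Insertion (star ∷ []) w

-- A weighted Dyck word is a sequence of blocks ⋆ x n y, each entered at an even height 2k,
-- carrying its weight n ≤ m at height 2m+1 and left at an even height. A word of positive size
-- is obtained by one insertion from a smaller one, located at its special weight j, which sits
-- in a block ⋆ D j y. If y = U, deleting D j U ⋆ undoes a column addition, made at a ⋆ to the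
-- right of every eligible weight. If y = D, the first later block with a maximal weight is some
-- ⋆ U l, since a maximal weight after a D would be eligible. Deleting ⋆ D j D, turning that U
-- into D and moving the boxes in between one block to the right lowers these blocks by one
-- level, which their non-maximal weights allow; then ⋆ D l is special and the column addition
-- at the old ⋆ followed by the ribbon addition restores the word.

module Submission where

open import Defs
open import Data.Nat as ℕ using (ℕ; zero; suc; z≤n; s≤s)
import Data.Nat.Properties as ℕP
open import Data.Integer using (ℤ; +_; -_; _+_; _<_; _≤_; 0ℤ; 1ℤ; +≤+; +<+)
import Data.Integer.Properties as ℤP
open import Data.List using (List; []; _∷_; _++_; length)
import Data.List.Properties as List
open import Data.Product using (Σ; ∃; ∃₂; _×_; _,_; proj₁; proj₂)
open import Data.Sum using (_⊎_; inj₁; inj₂)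
open import Data.Empty using (⊥; ⊥-elim)
open import Relation.Nullary using (¬_; Dec; yes; no)
open import Relation.Nullary.Decidable using (map′)
open import Relation.Binary.PropositionalEquality
open import Relation.Binary.Construct.Closure.ReflexiveTransitive using (ε; _◅_; _◅◅_)

double : ℕ → ℕ
double zero    = zero
double (suc n) = suc (suc (double n))

level : ℕ → ℤ
level k = + double k

odd : ℕ → ℤ
odd m = + suc (double m)

level-+1 : ∀ k → level k + 1ℤ ≡ odd k
level-+1 k = ℤP.+-comm (level k) 1ℤ

⌊double/2⌋ : ∀ n → ℕ.⌊ double n /2⌋ ≡ n
⌊double/2⌋ zero    = refl
⌊double/2⌋ (suc n) = cong suc (⌊double/2⌋ n)

ceilHalf-odd : ∀ m → ceilHalf (odd m) ≡ + suc m
ceilHalf-odd m = cong (λ k → + suc k) (⌊double/2⌋ m)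

ch-odd : ∀ a {m} → height a ≡ odd m → ch a ≡ + suc m
ch-odd _ {m} h = trans (cong ceilHalf h) (ceilHalf-odd m)

height-++ : ∀ p q → height (p ++ q) ≡ height p + height q
height-++ []          q = sym (ℤP.+-identityˡ _)
height-++ (star ∷ p)  q = height-++ p q
height-++ (U ∷ p)     q =
  trans (cong (_+_ (- 1ℤ)) (height-++ p q)) (sym (ℤP.+-assoc (- 1ℤ) (height p) (height q)))
height-++ (D ∷ p)     q =
  trans (cong (_+_ 1ℤ) (height-++ p q)) (sym (ℤP.+-assoc 1ℤ (height p) (height q)))
height-++ (num _ ∷ p) q = height-++ p q

+-height-++ : ∀ h p q → h + height (p ++ q) ≡ h + height p + height q
+-height-++ h p q = trans (cong (_+_ h) (height-++ p q)) (sym (ℤP.+-assoc h _ _))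

size-++ : ∀ p q → size (p ++ q) ≡ size p ℕ.+ size q
size-++ []          q = refl
size-++ (star ∷ p)  q = size-++ p q
size-++ (U ∷ p)     q = size-++ p q
size-++ (D ∷ p)     q = size-++ p q
size-++ (num _ ∷ p) q = cong suc (size-++ p q)

size-++-insert : ∀ pre post post′ → size post ≡ suc (size post′) →
                 size (pre ++ post) ≡ suc (size (pre ++ post′))
size-++-insert pre post post′ e = begin
  size (pre ++ post)            ≡⟨ size-++ pre post ⟩
  size pre ℕ.+ size post        ≡⟨ cong (size pre ℕ.+_) e ⟩
  size pre ℕ.+ suc (size post′) ≡⟨ ℕP.+-suc (size pre) (size post′) ⟩
  suc (size pre ℕ.+ size post′) ≡⟨ cong suc (size-++ pre post′) ⟨
  suc (size (pre ++ post′))     ∎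
  where open ≡-Reasoning

++-split : ∀ {A : Set} (a r a′ r′ : List A) → a ++ r ≡ a′ ++ r′ → length a ℕ.≤ length a′ →
           ∃ λ t → a′ ≡ a ++ t × r ≡ t ++ r′
++-split []      r a′       r′ eq _         = a′ , refl , eq
++-split (x ∷ a) r (_ ∷ a′) r′ eq (s≤s le) with List.∷-injective eq
... | refl , eq′ with ++-split a r a′ r′ eq′ le
...   | t , refl , r≡ = t , refl , r≡

-- A record rather than a Π-type, so that P and h are recovered by unification at use sites.
record AtEveryCut (P : ℤ → Word → Set) (h : ℤ) (w : Word) : Set where
  constructor atEveryCut
  field cut : ∀ p r → w ≡ p ++ r → P (h + height p) r
open AtEveryCut

module _ {P : ℤ → Word → Set} where

  atEveryCut-head : ∀ {h w} → AtEveryCut P h w → P h w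
  atEveryCut-head {h} {w} all = subst (λ h′ → P h′ w) (ℤP.+-identityʳ h) (cut all [] w refl)

  atEveryCut-drop : ∀ {h h′} p {w} → AtEveryCut P h (p ++ w) → h + height p ≡ h′ → AtEveryCut P h′ w
  atEveryCut-drop {h} p all refl = atEveryCut λ where
    r s refl → subst (λ h′ → P h′ s) (+-height-++ h p r) (cut all (p ++ r) s (sym (List.++-assoc p r s)))

  atEveryCut-[] : ∀ {h} → P h [] → AtEveryCut P h []
  atEveryCut-[] {h} ph = atEveryCut λ where
    [] _ refl → subst (λ h′ → P h′ []) (sym (ℤP.+-identityʳ h)) ph

  atEveryCut-∷ : ∀ {h h′ x w} → P h (x ∷ w) → h + height (x ∷ []) ≡ h′ → AtEveryCut P h′ w →
                 AtEveryCut P h (x ∷ w)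
  atEveryCut-∷ {h} {x = x} {w} ph refl all = atEveryCut λ where
    []      _ refl → subst (λ h′ → P h′ (x ∷ w)) (sym (ℤP.+-identityʳ h)) ph
    (_ ∷ p) r refl → subst (λ h′ → P h′ r) (sym (+-height-++ h (x ∷ []) p)) (cut all p r refl)

-- Block k x y m k′ : the letters x, y of a block ⋆ x n y entered at height 2k, whose weight n
-- sits at height 2m+1 (column height m+1), and which is left at height 2k′.
data Block : ℕ → Letter → Letter → ℕ → ℕ → Set where
  D-D : ∀ {k} → Block k D D k (suc k)
  D-U : ∀ {k} → Block k D U k k
  U-D : ∀ {k} → Block (suc k) U D k (suc k)
  U-U : ∀ {k} → Block (suc k) U U k k

block-letters : ∀ {k x y m k′} → Block k x y m k′ → UD x × UD y
block-letters D-D = isD , isD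
block-letters D-U = isD , isU
block-letters U-D = isU , isD
block-letters U-U = isU , isU

block-in : ∀ {k x y m k′} → Block k x y m k′ → level k + height (x ∷ []) ≡ odd m
block-in {k} D-D = level-+1 k
block-in {k} D-U = level-+1 k
block-in U-D = refl
block-in U-U = refl

block-out : ∀ {k x y m k′} → Block k x y m k′ → odd m + height (y ∷ []) ≡ level k′
block-out {m = m} D-D = ℤP.+-comm (odd m) 1ℤ
block-out D-U = refl
block-out {m = m} U-D = ℤP.+-comm (odd m) 1ℤ
block-out U-U = refl

block-height : ∀ {k x y m k′} n → Block k x y m k′ →
               level k + height (star ∷ x ∷ num n ∷ y ∷ []) ≡ level k′
block-height {k} {x} {y} {m} n b = begin
  level k + height (x ∷ num n ∷ y ∷ [])          ≡⟨ +-height-++ (level k) (x ∷ []) (num n ∷ y ∷ []) ⟩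
  level k + height (x ∷ []) + height (y ∷ [])    ≡⟨ cong (_+ height (y ∷ [])) (block-in b) ⟩
  odd m + height (y ∷ [])                        ≡⟨ block-out b ⟩
  level _                                         ∎
  where open ≡-Reasoning

block-shift : ∀ {k x y m k′} n w → Block k x y m k′ →
              level k + height (star ∷ x ∷ num n ∷ y ∷ w) ≡ level k′ + height w
block-shift {k} {x} {y} n w b =
  trans (+-height-++ (level k) (star ∷ x ∷ num n ∷ y ∷ []) w) (cong (_+ height w) (block-height n b))

-- Path k p j: blocks leading from height 2k to height 2j; Tail k w: blocks leading from height
-- 2k to height 0, followed by the last ⋆.
data Path : ℕ → Word → ℕ → Set where
  nil   : ∀ {k} → Path k [] k
  block : ∀ {k x y m k′ n w j} → Block k x y m k′ → n ℕ.≤ m → Path k′ w j →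
          Path k (star ∷ x ∷ num n ∷ y ∷ w) j

data Tail : ℕ → Word → Set where
  end   : Tail 0 (star ∷ [])
  block : ∀ {k x y m k′ n w} → Block k x y m k′ → n ℕ.≤ m → Tail k′ w →
          Tail k (star ∷ x ∷ num n ∷ y ∷ w)

path-height : ∀ {k p j} → Path k p j → level k + height p ≡ level j
path-height nil                            = ℤP.+-identityʳ _
path-height (block {n = n} {w = w} b _ p) = trans (block-shift n w b) (path-height p)

path-height₀ : ∀ {p j} → Path 0 p j → height p ≡ level j
path-height₀ p = trans (sym (ℤP.+-identityˡ _)) (path-height p)

path-++-tail : ∀ {k p j w} → Path k p j → Tail j w → Tail k (p ++ w)
path-++-tail nil             t = t
path-++-tail (block b le p) t = block b le (path-++-tail p t)

tail-head : ∀ {k w} → Tail k w → ∃ λ w′ → w ≡ star ∷ w′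
tail-head end           = _ , refl
tail-head (block _ _ _) = _ , refl

Valid : ℤ → Word → Set
Valid h r = 0ℤ ≤ h × (∀ n q → r ≡ num n ∷ q → + n < ceilHalf h)

WeightedDyckFrom : ℤ → Word → Set
WeightedDyckFrom h w = InLang w × AtEveryCut Valid h w × h + height w ≡ 0ℤ

valid-UD : ∀ {h x w} → UD x → 0ℤ ≤ h → Valid h (x ∷ w)
valid-UD isU h≥0 = h≥0 , λ _ _ ()
valid-UD isD h≥0 = h≥0 , λ _ _ ()

0≤+ : ∀ {n} → 0ℤ ≤ + n
0≤+ = +≤+ z≤n

weight-bound⁺ : ∀ {n m} → n ℕ.≤ m → + n < ceilHalf (odd m)
weight-bound⁺ {n} {m} n≤m = subst (+ n <_) (sym (ceilHalf-odd m)) (+<+ (s≤s n≤m))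

weight-bound⁻ : ∀ {n m} → + n < ceilHalf (odd m) → n ℕ.≤ m
weight-bound⁻ {n} {m} lt with subst (+ n <_) (ceilHalf-odd m) lt
... | +<+ (s≤s n≤m) = n≤m

valid-block : ∀ {k x y m k′ n w} → Block k x y m k′ → n ℕ.≤ m → AtEveryCut Valid (level k′) w →
              AtEveryCut Valid (level k) (star ∷ x ∷ num n ∷ y ∷ w)
valid-block b n≤m valid =
  atEveryCut-∷ (0≤+ , λ _ _ ()) (ℤP.+-identityʳ _) (
  atEveryCut-∷ (valid-UD (proj₁ (block-letters b)) 0≤+) (block-in b) (
  atEveryCut-∷ (0≤+ , λ { _ _ refl → weight-bound⁺ n≤m }) (ℤP.+-identityʳ _) (
  atEveryCut-∷ (valid-UD (proj₂ (block-letters b)) 0≤+) (block-out b) valid)))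

block-exists : ∀ {k x y} → UD x → UD y → 0ℤ ≤ level k + height (x ∷ []) → ∃₂ λ m k′ → Block k x y m k′
block-exists         isD isD _ = _ , _ , D-D
block-exists         isD isU _ = _ , _ , D-U
block-exists {zero}  isU _   ()
block-exists {suc k} isU isD _ = _ , _ , U-D
block-exists {suc k} isU isU _ = _ , _ , U-U

valid-block⁻ : ∀ {k x y n w} → UD x → UD y → AtEveryCut Valid (level k) (star ∷ x ∷ num n ∷ y ∷ w) →
               ∃₂ λ m k′ → Block k x y m k′ × n ℕ.≤ m × AtEveryCut Valid (level k′) w
valid-block⁻ {x = x} {y} {n} ux uy valid
  with block-exists ux uy (proj₁ (atEveryCut-head (atEveryCut-drop (star ∷ x ∷ []) valid refl)))
... | m , k′ , b =
  m , k′ , b , weight-bound⁻ weight , atEveryCut-drop (star ∷ x ∷ num n ∷ y ∷ []) valid (block-height n b)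
  where
  weight : + n < ceilHalf (odd m)
  weight = proj₂ (atEveryCut-head (atEveryCut-drop (star ∷ x ∷ []) valid (block-in b))) n (y ∷ _) refl

tail⇒weightedDyckFrom : ∀ {k w} → Tail k w → WeightedDyckFrom (level k) w
tail⇒weightedDyckFrom end =
  last , atEveryCut-∷ (0≤+ , λ _ _ ()) refl (atEveryCut-[] (0≤+ , λ _ _ ())) , refl
tail⇒weightedDyckFrom (block {n = n} {w = w} b n≤m t) with tail⇒weightedDyckFrom t
... | lang , valid , closed =
  box (proj₁ (block-letters b)) (proj₂ (block-letters b)) lang ,
  valid-block b n≤m valid ,
  trans (block-shift n w b) closed

weightedDyckFrom⇒tail : ∀ {k w} → WeightedDyckFrom (level k) w → Tail k w
weightedDyckFrom⇒tail {zero}  (last , _) = end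
weightedDyckFrom⇒tail {suc k} (last , _ , ())
weightedDyckFrom⇒tail (box {n = n} {w = w} ux uy lang , valid , closed) with valid-block⁻ ux uy valid
... | _ , _ , b , n≤m , valid′ =
  block b n≤m (weightedDyckFrom⇒tail (lang , valid′ , trans (sym (block-shift n w b)) closed))

weightedDyck⇒tail : ∀ {w} → WeightedDyck w → Tail 0 w
weightedDyck⇒tail {w} (lang , (dyck , closed) , weights) =
  weightedDyckFrom⇒tail (lang , atEveryCut valid , trans (ℤP.+-identityˡ _) closed)
  where
  valid : ∀ p r → w ≡ p ++ r → Valid (0ℤ + height p) r
  valid p r eq = subst (λ h → Valid h r) (sym (ℤP.+-identityˡ (height p)))
    (dyck p r eq , λ n q r≡ → weights p n q (trans eq (cong (p ++_) r≡)))

tail⇒weightedDyck : ∀ {w} → Tail 0 w → WeightedDyck w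
tail⇒weightedDyck {w} t with tail⇒weightedDyckFrom t
... | lang , valid , closed =
  lang , (nonneg , trans (sym (ℤP.+-identityˡ _)) closed) , weights
  where
  nonneg : ∀ p q → w ≡ p ++ q → 0ℤ ≤ height p
  nonneg p q eq = subst (0ℤ ≤_) (ℤP.+-identityˡ (height p)) (proj₁ (cut valid p q eq))
  weights : WeightsOK w
  weights p n q eq =
    subst (λ h → + n < ceilHalf h) (ℤP.+-identityˡ (height p)) (proj₂ (cut valid p _ eq) n q refl)

NotEligible : ℤ → Word → Set
NotEligible h r = ∀ s b → r ≡ D ∷ num s ∷ b → + suc s ≡ ceilHalf (h + 1ℤ) → ⊥

NoEligible : ℤ → Word → Set
NoEligible = AtEveryCut NotEligible

eligible-before : ∀ {w a r a′ s b} → w ≡ a ++ r → NoEligible (height a) r → Eligible w a′ s b →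
                  length a′ ℕ.< length a
eligible-before {a = a} {r} {a′} {s} {b} w≡ ne (w≡′ , maximal) with length a ℕP.≤? length a′
... | no a≰a′ = ℕP.≰⇒> a≰a′
... | yes a≤a′ with ++-split a r a′ (D ∷ num s ∷ b) (trans (sym w≡) w≡′) a≤a′
...   | t , refl , r≡ = ⊥-elim (cut ne t _ r≡ s b refl (trans maximal (cong ceilHalf
          (trans (height-++ (a ++ t) (D ∷ [])) (cong (_+ 1ℤ) (height-++ a t))))))

no-eligible-after : ∀ {w a r c s b} → w ≡ a ++ r → NoEligible (height a) r → ¬ Eligible w (a ++ c) s b
no-eligible-after {a = a} w≡ ne el = ℕP.<⇒≱ (eligible-before w≡ ne el) (List.length-++-≤ˡ a)

special-of-last : ∀ {w a s b} → Eligible w a s b → NoEligible (height (a ++ D ∷ [])) b → Special w a s b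
special-of-last {w} {a} {s} {b} el ne = el , λ a′ s′ b′ el′ →
  ℕP.m<1+n⇒m≤n (subst (length a′ ℕ.<_) length-snoc (eligible-before w≡ ne′ el′))
  where
  w≡ : w ≡ (a ++ D ∷ []) ++ num s ∷ b
  w≡ = trans (proj₁ el) (sym (List.++-assoc a (D ∷ []) (num s ∷ b)))
  ne′ : NoEligible (height (a ++ D ∷ [])) (num s ∷ b)
  ne′ = atEveryCut-∷ (λ _ _ ()) (ℤP.+-identityʳ _) ne
  length-snoc : length (a ++ D ∷ []) ≡ suc (length a)
  length-snoc = trans (List.length-++ a) (ℕP.+-comm (length a) 1)

tail-notEligible : ∀ {k w h y} → Tail k w → NotEligible h (y ∷ w)
tail-notEligible end           _ _ ()
tail-notEligible (block _ _ _) _ _ ()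

eligible? : ∀ {k x y m k′} → Block k x y m k′ → ∀ n → Dec (x ≡ D × n ≡ m)
eligible? D-D n = map′ (refl ,_) proj₂ (n ℕ.≟ _)
eligible? D-U n = map′ (refl ,_) proj₂ (n ℕ.≟ _)
eligible? U-D n = no λ ()
eligible? U-U n = no λ ()

D-block-mid : ∀ {k y m k′} → Block k D y m k′ → k ≡ m
D-block-mid D-D = refl
D-block-mid D-U = refl

maximal-D-eligible : ∀ {k y m k′ w} → Block k D y m k′ → ¬ NoEligible (level k) (star ∷ D ∷ num m ∷ y ∷ w)
maximal-D-eligible {k} {m = m} b ne =
  atEveryCut-head (atEveryCut-drop (star ∷ []) ne (ℤP.+-identityʳ (level k))) m _ refl
    (sym (trans (cong ceilHalf (block-in b)) (ceilHalf-odd m)))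

noEligible-block : ∀ {k x y m k′ n w} → Block k x y m k′ → ¬ (x ≡ D × n ≡ m) → Tail k′ w →
                   NoEligible (level k′) w → NoEligible (level k) (star ∷ x ∷ num n ∷ y ∷ w)
noEligible-block {k} {x} {y} {m} {k′} {n} {w} b not-max t ne =
  atEveryCut-∷ (λ _ _ ()) (ℤP.+-identityʳ (level k)) (
  atEveryCut-∷ at-x (block-in b) (
  atEveryCut-∷ (λ _ _ ()) (ℤP.+-identityʳ (odd m)) (
  atEveryCut-∷ (tail-notEligible {h = odd m} t) (block-out b) ne)))
  where
  at-x : NotEligible (level k) (x ∷ num n ∷ y ∷ w)
  at-x _ _ refl maximal = not-max (refl , ℕP.suc-injective (ℤP.+-injective
    (trans maximal (trans (cong ceilHalf (block-in b)) (ceilHalf-odd m)))))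

LastEligible : ℕ → Word → Set
LastEligible k w = Σ Word λ pre → Σ ℕ λ j → Σ Letter λ y → Σ ℕ λ k′ → Σ Word λ post →
  w ≡ pre ++ star ∷ D ∷ num j ∷ y ∷ post × Path k pre j × Block j D y j k′ × Tail k′ post ×
  NoEligible (odd j) (y ∷ post)

last-eligible : ∀ {k w} → Tail k w → NoEligible (level k) w ⊎ LastEligible k w
last-eligible end = inj₁ (atEveryCut-∷ (λ _ _ ()) refl (atEveryCut-[] {h = 0ℤ} λ _ _ ()))
last-eligible (block {x = x} {y} {m} {n = n} {w} b n≤m t) with last-eligible t
... | inj₂ (pre , j , y′ , k″ , post , refl , p , b′ , t′ , ne) =
  inj₂ (star ∷ x ∷ num n ∷ y ∷ pre , j , y′ , k″ , post , refl , block b n≤m p , b′ , t′ , ne)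
... | inj₁ ne with eligible? b n
...   | no not-max = inj₁ (noEligible-block b not-max t ne)
...   | yes (refl , refl) with D-block-mid b
...     | refl = inj₂ ([] , m , y , _ , w , refl , nil , b , t , ne′)
  where
  ne′ : NoEligible (odd m) (y ∷ w)
  ne′ = atEveryCut-∷ (tail-notEligible {h = odd m} t) (block-out b) ne

ReturnTo : ℕ → Word → Set
ReturnTo i v = Σ Word λ q → Σ ℕ λ l → Σ Word λ b →
  v ≡ q ++ star ∷ U ∷ num l ∷ b × Path i q l × Tail l (star ∷ D ∷ num l ∷ b) × NoEligible (odd l) b

block-lower : ∀ {i x y m k} → Block (suc i) x y (suc m) k → ∃ λ k′ → k ≡ suc k′ × Block i x y m k′
block-lower D-D = _ , refl , D-D
block-lower D-U = _ , refl , D-U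
block-lower U-D = _ , refl , U-D
block-lower U-U = _ , refl , U-U

return-here : ∀ {i x y m k w} → Block (suc i) x y m k → Tail k w →
             NoEligible (level (suc i)) (star ∷ x ∷ num m ∷ y ∷ w) → ReturnTo i (star ∷ x ∷ num m ∷ y ∷ w)
return-here D-D _ ne = ⊥-elim (maximal-D-eligible D-D ne)
return-here D-U _ ne = ⊥-elim (maximal-D-eligible D-U ne)
return-here {i} {w = w} U-D t ne =
  [] , i , D ∷ w , refl , nil , block D-D ℕP.≤-refl t , atEveryCut-drop (star ∷ U ∷ num i ∷ []) ne refl
return-here {i} {w = w} U-U t ne =
  [] , i , U ∷ w , refl , nil , block D-U ℕP.≤-refl t , atEveryCut-drop (star ∷ U ∷ num i ∷ []) ne refl

-- All blocks before the first maximal weight are lowered by one level: they come from a height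
-- 2(i+1) word without eligible weights, so their weights stay below the lowered column heights.
find-return : ∀ {i v} → Tail (suc i) v → NoEligible (level (suc i)) v → ReturnTo i v
find-return (block {x = x} {y} {m} {n = n} b n≤m t) ne with n ℕ.≟ m
... | yes refl = return-here b t ne
... | no n≢m with ℕP.≤∧≢⇒< n≤m n≢m
...   | s≤s n≤m′ with block-lower b
...     | _ , refl , b′
  with find-return t (atEveryCut-drop (star ∷ x ∷ num n ∷ y ∷ []) ne (block-height n b))
... | q , l , r , refl , p , t′ , ne′ =
  star ∷ x ∷ num n ∷ y ∷ q , l , r , refl , block b′ n≤m′ p , t′ , ne′

path-rotate : ∀ {i q l} → Path i q l →
              ∃ λ c → (∀ r → q ++ star ∷ r ≡ star ∷ c ++ r) × height c ≡ height q
path-rotate nil = [] , (λ _ → refl) , refl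
path-rotate (block {x = x} {y} {n = n} {w} _ _ _) =
  body ++ star ∷ [] ,
  (λ r → cong (star ∷_) (sym (List.++-assoc body (star ∷ []) r))) ,
  trans (height-++ body (star ∷ [])) (ℤP.+-identityʳ (height body))
  where
  body : Word
  body = x ∷ num n ∷ y ∷ w

Preimage : Word → Set
Preimage w = Σ Word λ w₀ → Tail 0 w₀ × Insertion w₀ w × size w ≡ suc (size w₀)

ch-column : ∀ pre {j} → height pre ≡ level j → + suc j ≡ ch (pre ++ star ∷ D ∷ [])
ch-column pre {j} h = sym (ch-odd (pre ++ star ∷ D ∷ [])
  (trans (height-++ pre (star ∷ D ∷ [])) (trans (cong (_+ 1ℤ) h) (level-+1 j))))

undo-column : ∀ {pre j post} → Path 0 pre j → Tail j post → NoEligible (odd j) (U ∷ post) →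
             Preimage (pre ++ star ∷ D ∷ num j ∷ U ∷ post)
undo-column {pre} {j} p t ne with tail-head t
... | post′ , refl =
  pre ++ star ∷ post′ , t₀ ,
  (tail⇒weightedDyck t₀ , pre , post′ , j , refl , ch-column pre hpre ,
    inj₁ ((λ _ _ _ sp → no-eligible-after refl ne′ (proj₁ sp)) , refl)) ,
  size-++-insert pre _ (star ∷ post′) refl
  where
  t₀ : Tail 0 (pre ++ star ∷ post′)
  t₀ = path-++-tail p t
  hpre : height pre ≡ level j
  hpre = path-height₀ p
  ne′ : NoEligible (height pre) (star ∷ post′)
  ne′ = atEveryCut-drop (U ∷ []) ne (sym hpre)

undo-ribbon : ∀ {pre j post} → Path 0 pre j → Tail (suc j) post → NoEligible (odd j) (D ∷ post) →
             Preimage (pre ++ star ∷ D ∷ num j ∷ D ∷ post)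
undo-ribbon {pre} {j} p t ne with find-return t (atEveryCut-drop (D ∷ []) ne (ℤP.+-comm (odd j) 1ℤ))
... | q , l , b , refl , pq , tl , nb with path-rotate pq
...   | c , rotate , hc =
  w₀ , t₀ ,
  (tail⇒weightedDyck t₀ , pre , c ++ D ∷ num l ∷ b , j , cong (pre ++_) (rotate _) ,
    ch-column pre hpre ,
    inj₂ (c , l , b , special , cong (λ z → pre ++ star ∷ D ∷ num j ∷ D ∷ z) (rotate _))) ,
  size-++-insert pre _ _ (cong suc (trans (size-++ q _) (sym (size-++ q _))))
  where
  w₀ : Word
  w₀ = pre ++ q ++ star ∷ D ∷ num l ∷ b
  t₀ : Tail 0 w₀
  t₀ = path-++-tail p (path-++-tail pq tl)
  hpre : height pre ≡ level j
  hpre = path-height₀ p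
  hD : height ((pre ++ star ∷ c) ++ D ∷ []) ≡ odd l
  hD = begin
    height ((pre ++ star ∷ c) ++ D ∷ []) ≡⟨ height-++ (pre ++ star ∷ c) (D ∷ []) ⟩
    height (pre ++ star ∷ c) + 1ℤ         ≡⟨ cong (_+ 1ℤ) (height-++ pre (star ∷ c)) ⟩
    height pre + height c + 1ℤ            ≡⟨ cong (_+ 1ℤ) (cong₂ _+_ hpre hc) ⟩
    level j + height q + 1ℤ               ≡⟨ cong (_+ 1ℤ) (path-height pq) ⟩
    level l + 1ℤ                          ≡⟨ level-+1 l ⟩
    odd l                                 ∎
    where open ≡-Reasoning
  special : Special w₀ (pre ++ star ∷ c) l b
  special = special-of-last
    (trans (cong (pre ++_) (rotate _)) (sym (List.++-assoc pre (star ∷ c) _)) ,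
     sym (ch-odd ((pre ++ star ∷ c) ++ D ∷ []) hD))
    (subst (λ h → NoEligible h b) (sym hD) nb)

first-block-eligible : ∀ {x y m k n w} → Block 0 x y m k → n ℕ.≤ m →
                       ¬ NoEligible 0ℤ (star ∷ x ∷ num n ∷ y ∷ w)
first-block-eligible D-D z≤n = maximal-D-eligible D-D
first-block-eligible D-U z≤n = maximal-D-eligible D-U

preimage : ∀ {w} → Tail 0 w → w ≡ star ∷ [] ⊎ Preimage w
preimage end = inj₁ refl
preimage t@(block b n≤m _) with last-eligible t
... | inj₁ ne = ⊥-elim (first-block-eligible b n≤m ne)
... | inj₂ (_ , _ , _ , _ , _ , w≡ , p , D-U , t′ , ne) =
  inj₂ (subst Preimage (sym w≡) (undo-column p t′ ne))
... | inj₂ (_ , _ , _ , _ , _ , w≡ , p , D-D , t′ , ne) =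
  inj₂ (subst Preimage (sym w≡) (undo-ribbon p t′ ne))

constructible-of-size : ∀ n {w} → size w ≡ n → Tail 0 w → Constructible w
constructible-of-size n e t with preimage t
... | inj₁ refl = ε
constructible-of-size zero    e t | inj₂ (_ , _ , _ , e₀) = ⊥-elim (ℕP.1+n≢0 (trans (sym e₀) e))
constructible-of-size (suc n) e t | inj₂ (w₀ , t₀ , insertion , e₀) =
  constructible-of-size n (ℕP.suc-injective (trans (sym e₀) e)) t₀ ◅◅ (insertion ◅ ε)

proposition6 : (w : Word) → WeightedDyck w → Constructible w
proposition6 w wd = constructible-of-size (size w) refl (weightedDyck⇒tail wd)
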